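{- Let $t:\rho$ be any term of Gödel's System $\mathrm{T}$. For every assignment of values to the translated free variables $x^\mathrm{b}$ ($x\in\mathrm{FV}(t)$) such that $\mathrm{C}(x^\mathrm{b})$ holds for every $x\in\mathrm{FV}(t)$, we have $\mathrm{C}_\rho(t^\mathrm{b})$.
   Context: Gödel's System $\mathrm{T}$: finite types are generated from the base type $\mathbb{N}$ by function types $\sigma\to\tau$. Terms are those of the simply typed lambda calculus (variables, $\lambda$-abstraction, application) extended with constants $0:\mathbb{N}$, $\mathrm{succ}:\mathbb{N}\to\mathbb{N}$ and, for each finite type $\rho$, $\mathrm{rec}_\rho:\rho\to(\mathbb{N}\to\rho\to\rho)\to\mathbb{N}\to\rho$ with $\mathrm{rec}(a)(f)(0)=a$ and $\mathrm{rec}(a)(f)(\mathrm{succ}\,n)=f(n)(\mathrm{rec}(a)(f)(n))$. The $\mathrm{b}$-translation: types are translated by $\mathbb{N}^\mathrm{b}:\equiv(\mathbb{N}\to\mathbb{N})\to\mathbb{N}$ and $(\sigma\to\tau)^\mathrm{b}:\equiv\sigma^\mathrm{b}\to\tau^\mathrm{b}$. Each variable $x:\rho$ is assigned a variable $x^\mathrm{b}:\rho^\mathrm{b}$, and terms are translated by $(x)^\mathrm{b}:\equiv x^\mathrm{b}$, $(\lambda x.u)^\mathrm{b}:\equiv\lambda x^\mathrm{b}.u^\mathrm{b}$, $(fa)^\mathrm{b}:\equiv f^\mathrm{b}a^\mathrm{b}$, $0^\mathrm{b}:\equiv\lambda\alpha.0$, $\mathrm{succ}^\mathrm{b}:\equiv\lambda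 f\alpha.\mathrm{succ}(f\alpha)$, $\mathrm{rec}^\mathrm{b}:\equiv\lambda af.\mathrm{ke}(\mathrm{rec}(a)(\lambda k.f(\lambda\alpha.k)))$, where $\mathrm{ke}_\rho:(\mathbb{N}\to\rho^\mathrm{b})\to\mathbb{N}^\mathrm{b}\to\rho^\mathrm{b}$ is defined by $\mathrm{ke}_\mathbb{N}(g)(f):\equiv\lambda\alpha.g(f\alpha)(\alpha)$ and $\mathrm{ke}_{\sigma\to\tau}(g)(f):\equiv\lambda x.\mathrm{ke}_\tau(\lambda k.g(k)(x))(f)$. A function $f:(\mathbb{N}\to\mathbb{N})\to\mathbb{N}$ is continuous if for every $\alpha:\mathbb{N}\to\mathbb{N}$ there is $m:\mathbb{N}$ such that for all $\beta:\mathbb{N}\to\mathbb{N}$ with $\alpha_i=\beta_i$ for all $i<m$, $f(\alpha)=f(\beta)$. The predicate $\mathrm{C}_\rho\subseteq\rho^\mathrm{b}$ is defined by: $\mathrm{C}_\mathbb{N}(f)$ iff $f$ is continuous; $\mathrm{C}_{\sigma\to\tau}(g)$ iff for all $x:\sigma^\mathrm{b}$, $\mathrm{C}_\sigma(x)$ implies $\mathrm{C}_\tau(g(x))$. -}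

module Defs where

open import Data.Nat using (ℕ; zero; suc)
open import Data.Product using (Σ)
open import Relation.Binary.PropositionalEquality using (_≡_)

infixr 7 _⇒_
data Ty : Set where
  ι   : Ty
  _⇒_ : Ty → Ty → Ty

infixl 5 _▸_
data Ctx : Set where
  ε   : Ctx
  _▸_ : Ctx → Ty → Ctx

data Var : Ctx → Ty → Set where
  here  : ∀ {Γ σ} → Var (Γ ▸ σ) σ
  there : ∀ {Γ σ τ} → Var Γ σ → Var (Γ ▸ τ) σ

infixl 6 _·_
data Tm (Γ : Ctx) : Ty → Set where
  var  : ∀ {σ} → Var Γ σ → Tm Γ σ
  lam  : ∀ {σ τ} → Tm (Γ ▸ σ) τ → Tm Γ (σ ⇒ τ)
  _·_  : ∀ {σ τ} → Tm Γ (σ ⇒ τ) → Tm Γ σ → Tm Γ τ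
  Zero : Tm Γ ι
  Succ : Tm Γ (ι ⇒ ι)
  Rec  : ∀ ρ → Tm Γ (ρ ⇒ (ι ⇒ ρ ⇒ ρ) ⇒ ι ⇒ ρ)

data _∈FV_ {Γ : Ctx} {σ : Ty} (x : Var Γ σ) : ∀ {ρ} → Tm Γ ρ → Set where
  fv-var : x ∈FV var x
  fv-lam : ∀ {τ ρ} {u : Tm (Γ ▸ τ) ρ} → there x ∈FV u → x ∈FV lam u
  fv-appˡ : ∀ {τ ρ} {f : Tm Γ (τ ⇒ ρ)} {a : Tm Γ τ} → x ∈FV f → x ∈FV (f · a)
  fv-appʳ : ∀ {τ ρ} {f : Tm Γ (τ ⇒ ρ)} {a : Tm Γ τ} → x ∈FV a → x ∈FV (f · a)

⟦_⟧ : Ty → Set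
⟦ ι ⟧     = ℕ
⟦ σ ⇒ τ ⟧ = ⟦ σ ⟧ → ⟦ τ ⟧

Env : Ctx → Set
Env Γ = ∀ {σ} → Var Γ σ → ⟦ σ ⟧

extend : ∀ {Γ σ} → Env Γ → ⟦ σ ⟧ → Env (Γ ▸ σ)
extend e v here      = v
extend e v (there x) = e x

rec : ∀ {A : Set} → A → (ℕ → A → A) → ℕ → A
rec a f zero    = a
rec a f (suc n) = f n (rec a f n)

eval : ∀ {Γ ρ} → Tm Γ ρ → Env Γ → ⟦ ρ ⟧
eval (var x)  e = e x
eval (lam u)  e = λ v → eval u (extend e v)
eval (f · a)  e = eval f e (eval a e)
eval Zero     e = zero
eval Succ     e = suc
eval (Rec ρ)  e = rec

_ᵇ : Ty → Ty
ι ᵇ       = (ι ⇒ ι) ⇒ ι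
(σ ⇒ τ) ᵇ = σ ᵇ ⇒ τ ᵇ

_ᶜᵇ : Ctx → Ctx
ε ᶜᵇ       = ε
(Γ ▸ σ) ᶜᵇ = Γ ᶜᵇ ▸ σ ᵇ

varᵇ : ∀ {Γ σ} → Var Γ σ → Var (Γ ᶜᵇ) (σ ᵇ)
varᵇ here      = here
varᵇ (there x) = there (varᵇ x)

private
  v0 : ∀ {Γ σ} → Tm (Γ ▸ σ) σ
  v0 = var here
  v1 : ∀ {Γ σ τ} → Tm (Γ ▸ σ ▸ τ) σ
  v1 = var (there here)
  v2 : ∀ {Γ σ τ υ} → Tm (Γ ▸ σ ▸ τ ▸ υ) σ
  v2 = var (there (there here))
  v3 : ∀ {Γ σ τ υ ω} → Tm (Γ ▸ σ ▸ τ ▸ υ ▸ ω) σ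
  v3 = var (there (there (there here)))

-- ke_ρ : (ℕ → ρ^b) → ℕ^b → ρ^b
--   ke_ℕ(g)(f)     = λα. g(fα)(α)
--   ke_{σ→τ}(g)(f) = λx. ke_τ(λk. g(k)(x))(f)
ke : ∀ {Γ} ρ → Tm Γ ((ι ⇒ ρ ᵇ) ⇒ ι ᵇ ⇒ ρ ᵇ)
ke ι       = lam (lam (lam (v2 · (v1 · v0) · v0)))
ke (σ ⇒ τ) = lam (lam (lam (ke τ · lam (v3 · v0 · v1) · v1)))

zeroᵇ : ∀ {Γ} → Tm Γ (ι ᵇ)
zeroᵇ = lam Zero

succᵇ : ∀ {Γ} → Tm Γ (ι ᵇ ⇒ ι ᵇ)
succᵇ = lam (lam (Succ · (v1 · v0)))

-- rec^b = λaf. ke(rec(a)(λk. f(λα.k)))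
recᵇ : ∀ {Γ} ρ → Tm Γ ((ρ ⇒ (ι ⇒ ρ ⇒ ρ) ⇒ ι ⇒ ρ) ᵇ)
recᵇ ρ = lam (lam (ke ρ · (Rec (ρ ᵇ) · v1 · lam (v1 · lam v1))))

_ᵗᵇ : ∀ {Γ ρ} → Tm Γ ρ → Tm (Γ ᶜᵇ) (ρ ᵇ)
var x ᵗᵇ   = var (varᵇ x)
lam u ᵗᵇ   = lam (u ᵗᵇ)
(f · a) ᵗᵇ = (f ᵗᵇ) · (a ᵗᵇ)
Zero ᵗᵇ    = zeroᵇ
Succ ᵗᵇ    = succᵇ
Rec ρ ᵗᵇ   = recᵇ ρ

_=⟨_⟩_ : (ℕ → ℕ) → ℕ → (ℕ → ℕ) → Set
α =⟨ m ⟩ β = ∀ i → i Data.Nat.< m → α i ≡ β i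
  where import Data.Nat

continuous : ((ℕ → ℕ) → ℕ) → Set
continuous f = ∀ (α : ℕ → ℕ) → Σ ℕ λ m → ∀ (β : ℕ → ℕ) → α =⟨ m ⟩ β → f α ≡ f β

C : ∀ ρ → ⟦ ρ ᵇ ⟧ → Set
C ι       f = continuous f
C (σ ⇒ τ) g = ∀ (x : ⟦ σ ᵇ ⟧) → C σ x → C τ (g x)

module Submission where

open import Defs
open import Data.Nat using (ℕ; zero; suc; _≤_; _⊔_)
open import Data.Nat.Properties using (m≤m⊔n; m≤n⊔m; <-≤-trans)
open import Data.Product using (_,_)
open import Relation.Binary.PropositionalEquality using (refl; cong; trans)

-- The real content is ke:
-- λα. g (f α) α is continuous, with modulus at α the maximum of the moduli of
-- f at α and of g (f α) at α.  rec^b runs the recursion on plain numbers k,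
-- whose embeddings λα. k are trivially continuous, and then hands it to ke.

=⟨⟩-mono : ∀ {α β m n} → m ≤ n → α =⟨ n ⟩ β → α =⟨ m ⟩ β
=⟨⟩-mono m≤n α=β i i<m = α=β i (<-≤-trans i<m m≤n)

const-continuous : (k : ℕ) → continuous (λ _ → k)
const-continuous k α = 0 , λ _ _ → refl

continuous-bind : ∀ {f : (ℕ → ℕ) → ℕ} {g : ℕ → (ℕ → ℕ) → ℕ}
                → continuous f → (∀ k → continuous (g k))
                → continuous (λ α → g (f α) α)
continuous-bind {f} {g} f-cont g-cont α with f-cont α | g-cont (f α) α
... | m , f-mod | n , g-mod = m ⊔ n , λ β α=β →
  trans (g-mod β (=⟨⟩-mono (m≤n⊔m m n) α=β))
        (cong (λ k → g k β) (f-mod β (=⟨⟩-mono (m≤m⊔n m n) α=β)))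

continuous-map : ∀ {f : (ℕ → ℕ) → ℕ} (h : ℕ → ℕ)
               → continuous f → continuous (λ α → h (f α))
continuous-map h f-cont = continuous-bind f-cont (λ k → const-continuous (h k))

rec-preserves : ∀ {A : Set} (P : A → Set) {a : A} {h : ℕ → A → A}
              → P a → (∀ k {y} → P y → P (h k y)) → ∀ k → P (rec a h k)
rec-preserves P pa ph zero    = pa
rec-preserves P pa ph (suc k) = ph k (rec-preserves P pa ph k)

C-ke : ∀ {Γ} ρ (e : Env Γ) {g : ℕ → ⟦ ρ ᵇ ⟧}
     → (∀ k → C ρ (g k)) → C (ι ⇒ ρ) (eval (ke ρ) e g)
C-ke ι       e g-C n n-C = continuous-bind n-C g-C
C-ke (σ ⇒ τ) e g-C n n-C x x-C = C-ke τ _ (λ k → g-C k x x-C) n n-C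

C-zeroᵇ : ∀ {Γ} (e : Env Γ) → C ι (eval zeroᵇ e)
C-zeroᵇ e = const-continuous 0

C-succᵇ : ∀ {Γ} (e : Env Γ) → C (ι ⇒ ι) (eval succᵇ e)
C-succᵇ e f f-C = continuous-map suc f-C

C-recᵇ : ∀ {Γ} ρ (e : Env Γ) → C (ρ ⇒ (ι ⇒ ρ ⇒ ρ) ⇒ ι ⇒ ρ) (eval (recᵇ ρ) e)
C-recᵇ ρ e a a-C f f-C =
  C-ke ρ _ (rec-preserves (C ρ) a-C (λ k → f-C (λ _ → k) (const-continuous k) _))

lemma3p2 : ∀ {Γ ρ} (t : Tm Γ ρ) (e : Env (Γ ᶜᵇ))
             → (∀ {σ} (x : Var Γ σ) → x ∈FV t → C σ (e (varᵇ x)))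
             → C ρ (eval (t ᵗᵇ) e)
lemma3p2 (var x) e e-C = e-C x fv-var
lemma3p2 {Γ} (lam {σ} u) e e-C x x-C = lemma3p2 u (extend e x) extend-C
  where
  extend-C : ∀ {τ} (y : Var (Γ ▸ σ) τ) → y ∈FV u → C τ (extend e x (varᵇ y))
  extend-C here      _    = x-C
  extend-C (there y) y∈u = e-C y (fv-lam y∈u)
lemma3p2 (f · a) e e-C =
  lemma3p2 f e (λ x x∈f → e-C x (fv-appˡ x∈f)) _
           (lemma3p2 a e (λ x x∈a → e-C x (fv-appʳ x∈a)))
lemma3p2 Zero    e _ = C-zeroᵇ e
lemma3p2 Succ    e _ = C-succᵇ e
lemma3p2 (Rec ρ) e _ = C-recᵇ ρ e
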